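{- Let $q$ be a positive integer, let $S$ be a numerical semigroup, let $n\in S\setminus\{0\}$, and for $0\leq i\leq n-1$ let $w(i)$ be the least element of $S$ congruent to $i$ modulo $n$. Suppose $\{s_1,\dots,s_r\}\subseteq\{1,\dots,n-1\}$ is such that $S=\langle n,w(s_1),\dots,w(s_r)\rangle$. Then, writing $k_i:=(k-iq)\bmod n$, $$GM_q(S)=1+\frac1n\sum_{k=0}^{n-1}\min_{i\in\{s_1,\dots,s_r\}}\left\{qn,\ qw(i)-w(k)+w(k_i)\right\},$$ where for each $k$ the minimum is taken over the set consisting of $qn$ together with the numbers $qw(i)-w(k)+w(k_i)$ for $i\in\{s_1,\dots,s_r\}$.
   Context: A numerical semigroup is an additive submonoid $S\subseteq\mathbb N$ with finite complement; $\langle g_1,\dots,g_m\rangle$ denotes the set of $\mathbb N$-linear combinations of $g_1,\dots,g_m$. For integers $a$ and $b\geq1$, $a\bmod b$ denotes the remainder in $\{0,\dots,b-1\}$. Write $S^*=S\setminus\{0\}$, $qS^*+S=\{qa+b: a\in S^*,\ b\in S\}$, and $GM_q(S):=\#\big(S\setminus (qS^*+S)\big)+1$. -}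

module Defs where

open import Data.Nat using (ℕ; zero; suc; _+_; _*_; _≤_; _<_; NonZero)
open import Data.Integer as ℤ using (ℤ; +_; _-_; _⊓_; 0ℤ; _%ℕ_)
open import Data.Nat.ListAction using (sum)
open import Data.List using (List; []; _∷_; length; zipWith; map; foldr; upTo)
open import Data.List.Membership.Propositional using (_∈_)
open import Data.List.Relation.Unary.Unique.Propositional using (Unique)
open import Data.Product using (Σ; ∃; _×_)
open import Function.Bundles using (_⇔_)
open import Relation.Binary.PropositionalEquality using (_≡_; _≢_)
open import Level using (0ℓ; suc)

record NumericalSemigroup : Set₁ where
  field
    mem      : ℕ → Set
    zero∈    : mem 0
    +-closed : ∀ {a b} → mem a → mem b → mem (a + b)
    cofinite : ∃ λ F → ∀ x → F ≤ x → mem x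
open NumericalSemigroup public

LinComb : List ℕ → ℕ → Set
LinComb gs x = Σ (List ℕ) λ cs → length cs ≡ length gs × x ≡ sum (zipWith _*_ cs gs)

GeneratedBy : NumericalSemigroup → List ℕ → Set
GeneratedBy S gs = ∀ x → mem S x ⇔ LinComb gs x

InQSstarPlusS : ℕ → NumericalSemigroup → ℕ → Set
InQSstarPlusS q S x = ∃ λ a → ∃ λ b → mem S a × a ≢ 0 × mem S b × x ≡ q * a + b

GMSet : ℕ → NumericalSemigroup → ℕ → Set
GMSet q S x = mem S x × (InQSstarPlusS q S x → Data.Empty.⊥)
  where import Data.Empty

HasCard : (ℕ → Set) → ℕ → Set
HasCard P c = Σ (List ℕ) λ xs → Unique xs × (∀ x → (x ∈ xs) ⇔ P x) × length xs ≡ c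

IsAperyElem : NumericalSemigroup → (n i w : ℕ) .{{_ : NonZero n}} → Set
IsAperyElem S n i w = mem S w × w Data.Nat.% n ≡ i ×
                      (∀ x → mem S x → x Data.Nat.% n ≡ i → w ≤ x)
  where import Data.Nat

sumℤ : List ℤ → ℤ
sumℤ = foldr ℤ._+_ 0ℤ

kIdx : (q n k i : ℕ) .{{_ : NonZero n}} → ℕ
kIdx q n k i = (+ k - + (i * q)) %ℕ n

minTerm : (q n : ℕ) .{{_ : NonZero n}} → (w : ℕ → ℕ) → List ℕ → ℕ → ℤ
minTerm q n w ss k =
  foldr _⊓_ (+ (q * n)) (map (λ i → + (q * w i) - + (w k) ℤ.+ + (w (kIdx q n k i))) ss)

theSum : (q n : ℕ) .{{_ : NonZero n}} → (w : ℕ → ℕ) → List ℕ → ℤ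
theSum q n w ss = sumℤ (map (minTerm q n w ss) (upTo n))

module Submission where

-- In the residue class k modulo n, S consists of w(k), w(k) + n, w(k) + 2n, …  Every element of S*
-- has a generator g ∈ {n, w(s₁), …, w(sᵣ)} as a summand, so qS* + S is the union of the sets q·g + S,
-- and in class k the set q·g + S starts at q·g + w((k − q·g) mod n), where (k − q·w(i)) mod n = kᵢ.
-- Hence qS* + S meets class k exactly in the elements ≥ M(k), the least of these values, and
-- S ∖ (qS* + S) meets it in the (M(k) − w(k))/n elements w(k) + t·n below M(k); the k-th summand of
-- the formula is M(k) − w(k).

open import Data.Nat.Base using (ℕ; NonZero; _<_; _≤_; _%_)
open import Relation.Binary.PropositionalEquality using (_≡_)
open import Data.List using (List; _∷_; map)
open import Data.List.Relation.Unary.All using (All)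
open import Data.Product using (_×_)
open import Defs

module Residues (n : ℕ) .{{_ : NonZero n}} where

  open import Data.Nat
  open import Data.Nat.Properties
  open import Data.Nat.DivMod
  open import Data.Nat.Divisibility using (m%n≡0⇒n∣m)
  open import Data.Integer as ℤ using (+_; -[1+_]; _%ℕ_; _/ℕ_)
    renaming (_+_ to _+ℤ_; _*_ to _*ℤ_; _-_ to _-ℤ_; -_ to -ℤ_)
  import Data.Integer.Properties as ℤ
  open import Data.Integer.DivMod using (a≡a%ℕn+[a/ℕn]*n)
  open import Data.Integer.Tactic.RingSolver using (solve-∀)
  open import Relation.Binary.PropositionalEquality
  open ≡-Reasoning

  +m≡+o+kn⇒m%n≡o%n : ∀ m o k → + m ≡ + o +ℤ k *ℤ + n → m % n ≡ o % n
  +m≡+o+kn⇒m%n≡o%n m o (+ k) eq = begin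
    m % n           ≡⟨ %-congˡ (ℤ.+-injective (trans eq (cong (+ o +ℤ_) (sym (ℤ.pos-* k n))))) ⟩
    (o + k * n) % n ≡⟨ [m+kn]%n≡m%n o k n ⟩
    o % n           ∎
  +m≡+o+kn⇒m%n≡o%n m o k@(-[1+ _ ]) eq =
    sym (+m≡+o+kn⇒m%n≡o%n o m (-ℤ k) (trans (x≡x+yz-yz (+ o) k (+ n)) (cong (_+ℤ -ℤ k *ℤ + n) (sym eq))))
    where
    x≡x+yz-yz : ∀ x y z → x ≡ x +ℤ y *ℤ z +ℤ -ℤ y *ℤ z
    x≡x+yz-yz = solve-∀

  decomposeℤ : ∀ m → + m ≡ + (m % n) +ℤ + (m / n) *ℤ + n
  decomposeℤ m = trans (cong +_ (m≡m%n+[m/n]*n m n)) (cong (+ (m % n) +ℤ_) (ℤ.pos-* (m / n) n))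

  %-cancelʳ-+ : ∀ m o p → (m + o) % n ≡ (p + o) % n → m % n ≡ p % n
  %-cancelʳ-+ m o p eq = +m≡+o+kn⇒m%n≡o%n m p (+ a -ℤ + b) (begin
    + m                                             ≡⟨ x≡x+y-y (+ m) (+ o) ⟩
    + (m + o) -ℤ + o                                ≡⟨ cong (_-ℤ + o) (decomposeℤ (m + o)) ⟩
    + r +ℤ + a *ℤ + n -ℤ + o                        ≡⟨ regroup (+ r) (+ a) (+ b) (+ n) (+ o) ⟩
    + r +ℤ + b *ℤ + n -ℤ + o +ℤ (+ a -ℤ + b) *ℤ + n ≡⟨ cong (λ v → v -ℤ + o +ℤ (+ a -ℤ + b) *ℤ + n) p+o≡ ⟨
    + (p + o) -ℤ + o +ℤ (+ a -ℤ + b) *ℤ + n         ≡⟨ cong (_+ℤ (+ a -ℤ + b) *ℤ + n) (x≡x+y-y (+ p) (+ o)) ⟨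
    + p +ℤ (+ a -ℤ + b) *ℤ + n                      ∎)
    where
    r = (m + o) % n
    a = (m + o) / n
    b = (p + o) / n
    p+o≡ : + (p + o) ≡ + r +ℤ + b *ℤ + n
    p+o≡ = trans (decomposeℤ (p + o)) (cong (λ v → + v +ℤ + b *ℤ + n) (sym eq))
    x≡x+y-y : ∀ x y → x ≡ x +ℤ y -ℤ y
    x≡x+y-y = solve-∀
    regroup : ∀ r a b n o → r +ℤ a *ℤ n -ℤ o ≡ r +ℤ b *ℤ n -ℤ o +ℤ (a -ℤ b) *ℤ n
    regroup = solve-∀

  [[m-o]%ℕn+o]%n≡m%n : ∀ m o → ((+ m -ℤ + o) %ℕ n + o) % n ≡ m % n
  [[m-o]%ℕn+o]%n≡m%n m o = +m≡+o+kn⇒m%n≡o%n _ m (-ℤ q) (sym (begin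
    + m +ℤ -ℤ q *ℤ + n                   ≡⟨ unfold (+ m) (+ o) q (+ n) ⟩
    + m -ℤ + o +ℤ + o -ℤ q *ℤ + n        ≡⟨ cong (λ v → v +ℤ + o -ℤ q *ℤ + n) (a≡a%ℕn+[a/ℕn]*n (+ m -ℤ + o) n) ⟩
    + r +ℤ q *ℤ + n +ℤ + o -ℤ q *ℤ + n   ≡⟨ cancel (+ r) (q *ℤ + n) (+ o) ⟩
    + r +ℤ + o                           ∎))
    where
    q = (+ m -ℤ + o) /ℕ n
    r = (+ m -ℤ + o) %ℕ n
    unfold : ∀ x y q n → x +ℤ -ℤ q *ℤ n ≡ x -ℤ y +ℤ y -ℤ q *ℤ n
    unfold = solve-∀
    cancel : ∀ x y z → x +ℤ y +ℤ z -ℤ y ≡ x +ℤ z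
    cancel = solve-∀

  %-cong-+ : ∀ {m m' o o'} → m % n ≡ m' % n → o % n ≡ o' % n → (m + o) % n ≡ (m' + o') % n
  %-cong-+ {m} {m'} {o} {o'} eq₁ eq₂ = begin
    (m + o) % n             ≡⟨ %-distribˡ-+ m o n ⟩
    (m % n + o % n) % n     ≡⟨ cong₂ (λ x y → (x + y) % n) eq₁ eq₂ ⟩
    (m' % n + o' % n) % n   ≡⟨ %-distribˡ-+ m' o' n ⟨
    (m' + o') % n           ∎

  %-congʳ-* : ∀ o {m m'} → m % n ≡ m' % n → (o * m) % n ≡ (o * m') % n
  %-congʳ-* o {m} {m'} eq = begin
    (o * m) % n             ≡⟨ %-distribˡ-* o m n ⟩
    (o % n * (m % n)) % n   ≡⟨ cong (λ x → (o % n * x) % n) eq ⟩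
    (o % n * (m' % n)) % n  ≡⟨ %-distribˡ-* o m' n ⟨
    (o * m') % n            ∎

  m%n≡o%n⇒m≡o+[m∸o]/n*n : ∀ {m o} → o ≤ m → m % n ≡ o % n → m ≡ o + (m ∸ o) / n * n
  m%n≡o%n⇒m≡o+[m∸o]/n*n {m} {o} o≤m eq = begin
    m                     ≡⟨ m+[n∸m]≡n o≤m ⟨
    o + (m ∸ o)           ≡⟨ cong (λ v → o + v) (m/n*n≡m (m%n≡0⇒n∣m (m ∸ o) n [m∸o]%n≡0)) ⟨
    o + (m ∸ o) / n * n   ∎
    where
    [m∸o]%n≡0 : (m ∸ o) % n ≡ 0
    [m∸o]%n≡0 = trans (%-cancelʳ-+ (m ∸ o) o 0 (trans (cong (_% n) (m∸n+n≡m o≤m)) eq)) (m*n%n≡0 0 n)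

module MinimumFolds where

  open import Data.Nat
  open import Data.Nat.Properties
  open import Data.Integer as ℤ using (ℤ; +_)
  import Data.Integer.Properties as ℤ
  open import Data.List using ([]; _∷_; foldr; map)
  open import Data.List.Properties using (foldr-preservesᵇ; foldr-preservesᵒ)
  open import Data.List.Relation.Unary.All using (All)
  open import Data.List.Relation.Unary.Any using (Any)
  open import Data.Sum using (_⊎_; [_,_]′)
  open import Function using (_∘_)
  open import Relation.Binary using (_Preserves_⟶_)
  open import Relation.Binary.PropositionalEquality

  foldr-⊓-preserves : ∀ {p} (P : ℕ → Set p) {e xs} → P e → All P xs → P (foldr _⊓_ e xs)
  foldr-⊓-preserves P = foldr-preservesᵇ ⊓-preserves
    where
    ⊓-preserves : ∀ {x y} → P x → P y → P (x ⊓ y)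
    ⊓-preserves {x} {y} px py =
      [ (λ eq → subst P (sym eq) px) , (λ eq → subst P (sym eq) py) ]′ (⊓-sel x y)

  foldr-⊓-≤ : ∀ {v} e xs → e ≤ v ⊎ Any (_≤ v) xs → foldr _⊓_ e xs ≤ v
  foldr-⊓-≤ = foldr-preservesᵒ (λ x y → [ m≤n⇒m⊓o≤n y , m≤n⇒o⊓m≤n x ]′)

  mono-distrib-foldr-⊓ : ∀ {f : ℤ → ℤ} → f Preserves ℤ._≤_ ⟶ ℤ._≤_ → ∀ e xs →
                         f (+ foldr _⊓_ e xs) ≡ foldr ℤ._⊓_ (f (+ e)) (map (f ∘ +_) xs)
  mono-distrib-foldr-⊓ mono e []       = refl
  mono-distrib-foldr-⊓ {f} mono e (x ∷ xs) =
    trans (ℤ.mono-≤-distrib-⊓ mono (+ x) (+ foldr _⊓_ e xs))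
          (cong (f (+ x) ℤ.⊓_) (mono-distrib-foldr-⊓ mono e xs))

module FiniteSets where

  open import Data.Product using (_,_)
  open import Function using (_∘_)
  open import Function.Bundles using (_⇔_; mk⇔; Equivalence)
  open Equivalence

  HasCard-cong : ∀ {P Q : ℕ → Set} {c} → (∀ x → P x ⇔ Q x) → HasCard P c → HasCard Q c
  HasCard-cong P⇔Q (xs , unique , ∈⇔P , length≡c) =
    xs , unique , (λ x → mk⇔ (to (P⇔Q x) ∘ to (∈⇔P x)) (from (∈⇔P x) ∘ from (P⇔Q x))) , length≡c

module ResidueWindows {n : ℕ} .{{_ : NonZero n}} (lo hi : ℕ → ℕ)
  (lo%n : ∀ {k} → k < n → lo k % n ≡ k) (hi%n : ∀ {k} → k < n → hi k % n ≡ k)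
  (lo≤hi : ∀ {k} → k < n → lo k ≤ hi k) where

  open import Data.Nat
  open import Data.Nat.Properties
  open import Data.Nat.DivMod using ([m+kn]%n≡m%n; m%n<n)
  open import Data.Empty using (⊥)
  open import Relation.Binary.PropositionalEquality
  open import Data.Nat.ListAction using (sum)
  open import Data.List using (List; []; _∷_; length; map; concat; upTo)
  open import Data.List.Properties using (length-++; length-map; length-upTo)
  open import Data.List.Membership.Propositional using (_∈_)
  open import Data.List.Membership.Propositional.Properties
  import Data.List.Relation.Unary.All as All
  import Data.List.Relation.Unary.All.Properties as All
  open import Data.List.Relation.Unary.Unique.Propositional using (Unique)
  import Data.List.Relation.Unary.Unique.Propositional.Properties as Unique
  import Data.List.Relation.Unary.AllPairs.Properties as AllPairs
  open import Data.Product using (_×_; _,_)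
  open import Function using (id)
  open import Function.Bundles using (_⇔_; mk⇔)
  open Residues n

  InWindow : ℕ → Set
  InWindow x = lo (x % n) ≤ x × x < hi (x % n)

  width : ℕ → ℕ
  width k = (hi k ∸ lo k) / n

  hi≡lo+width*n : ∀ {k} → k < n → hi k ≡ lo k + width k * n
  hi≡lo+width*n k<n = m%n≡o%n⇒m≡o+[m∸o]/n*n (lo≤hi k<n) (trans (hi%n k<n) (sym (lo%n k<n)))

  window : ℕ → List ℕ
  window k = map (λ t → lo k + t * n) (upTo (width k))

  windows : List ℕ
  windows = concat (map window (upTo n))

  [lo+tn]%n≡k : ∀ {k} t → k < n → (lo k + t * n) % n ≡ k
  [lo+tn]%n≡k {k} t k<n = trans ([m+kn]%n≡m%n (lo k) t n) (lo%n k<n)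

  ∈window⇒%n : ∀ {k x} → k < n → x ∈ window k → x % n ≡ k
  ∈window⇒%n k<n x∈ with t , _ , refl ← ∈-map⁻ _ x∈ = [lo+tn]%n≡k t k<n

  ∈window⇒InWindow : ∀ {k x} → k < n → x ∈ window k → InWindow x
  ∈window⇒InWindow {k} k<n x∈ with t , t∈ , refl ← ∈-map⁻ _ x∈ rewrite [lo+tn]%n≡k t k<n =
    m≤m+n (lo k) (t * n) ,
    subst (lo k + t * n <_) (sym (hi≡lo+width*n k<n)) (+-monoʳ-< (lo k) (*-monoˡ-< n (∈-upTo⁻ t∈)))

  ∈windows⇒InWindow : ∀ {x} → x ∈ windows → InWindow x
  ∈windows⇒InWindow x∈ =
    let ws , x∈ws , ws∈ = ∈-concat⁻′ (map window (upTo n)) x∈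
        k , k∈ , ws≡   = ∈-map⁻ window ws∈
    in ∈window⇒InWindow (∈-upTo⁻ k∈) (subst (_ ∈_) ws≡ x∈ws)

  InWindow⇒∈windows : ∀ {x} → InWindow x → x ∈ windows
  InWindow⇒∈windows {x} (lo≤x , x<hi) =
    ∈-concat⁺′ (subst (_∈ window k) (sym x≡lo+tn) (∈-map⁺ _ (∈-upTo⁺ t<width)))
               (∈-map⁺ window (∈-upTo⁺ k<n))
    where
    k = x % n
    k<n = m%n<n x n
    t = (x ∸ lo k) / n
    x≡lo+tn : x ≡ lo k + t * n
    x≡lo+tn = m%n≡o%n⇒m≡o+[m∸o]/n*n lo≤x (sym (lo%n k<n))
    t<width : t < width k
    t<width = *-cancelʳ-< n t (width k) (+-cancelˡ-< (lo k) (t * n) (width k * n)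
      (subst₂ _<_ x≡lo+tn (hi≡lo+width*n k<n) x<hi))

  windows-unique : Unique windows
  windows-unique = Unique.concat⁺ (All.map⁺ (All.tabulate λ {k} _ → window-unique k))
                                  (AllPairs.map⁺ (AllPairs.applyUpTo⁺₁ id n disjoint))
    where
    window-unique : ∀ k → Unique (window k)
    window-unique k = Unique.map⁺ (λ {t} {t'} eq → *-cancelʳ-≡ t t' n (+-cancelˡ-≡ (lo k) _ _ eq))
                                  (Unique.upTo⁺ (width k))
    disjoint : ∀ {i j} → i < j → j < n → ∀ {x} → x ∈ window i × x ∈ window j → ⊥
    disjoint i<j j<n (x∈i , x∈j) =
      <⇒≢ i<j (trans (sym (∈window⇒%n (<-trans i<j j<n) x∈i)) (∈window⇒%n j<n x∈j))

  length-windows : ∀ ks → length (concat (map window ks)) ≡ sum (map width ks)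
  length-windows []       = refl
  length-windows (k ∷ ks) = trans (length-++ (window k))
    (cong₂ _+_ (trans (length-map _ (upTo (width k))) (length-upTo (width k))) (length-windows ks))

  InWindow-card : HasCard InWindow (sum (map width (upTo n)))
  InWindow-card = windows , windows-unique , (λ x → mk⇔ ∈windows⇒InWindow InWindow⇒∈windows) ,
                  length-windows (upTo n)

module NumericalSemigroups where

  open import Data.Nat
  open import Data.Nat.Properties
  open import Data.Nat.ListAction using (sum)
  open import Data.List using ([]; zipWith)
  open import Data.List.Membership.Propositional using (_∈_)
  open import Data.List.Relation.Unary.Any using (here; there)
  open import Data.Product using (∃-syntax; _,_)
  open import Data.Empty using (⊥-elim)
  open import Function.Bundles using (Equivalence)
  open import Relation.Binary.PropositionalEquality

  *-closed : ∀ (S : NumericalSemigroup) {a} → mem S a → ∀ t → mem S (t * a)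
  *-closed S a∈S zero    = zero∈ S
  *-closed S a∈S (suc t) = +-closed S a∈S (*-closed S a∈S t)

  LinComb-split : ∀ gs {a} → LinComb gs a → a ≢ 0 →
                  ∃[ g ] g ∈ gs × ∃[ a′ ] LinComb gs a′ × a ≡ g + a′
  LinComb-split []       ([]     , _   , a≡0) a≢0 = ⊥-elim (a≢0 a≡0)
  LinComb-split (g ∷ gs) (suc c ∷ cs , len , a≡) _ =
    g , here refl , c * g + sum (zipWith _*_ cs gs) , (c ∷ cs , len , refl) , trans a≡ (+-assoc g (c * g) _)
  LinComb-split (g ∷ gs) (zero ∷ cs , len , a≡) a≢0
    with g′ , g′∈ , a′ , (cs′ , len′ , a′≡) , a≡g′+a′ ← LinComb-split gs (cs , suc-injective len , a≡) a≢0 =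
    g′ , there g′∈ , a′ , (0 ∷ cs′ , cong suc len′ , a′≡) , a≡g′+a′

  ∈S*⇒generator+∈S : ∀ {S gs a} → GeneratedBy S gs → mem S a → a ≢ 0 →
                     ∃[ g ] g ∈ gs × ∃[ a′ ] mem S a′ × a ≡ g + a′
  ∈S*⇒generator+∈S {gs = gs} {a} gen a∈S a≢0
    with g , g∈ , a′ , a′-comb , a≡ ← LinComb-split gs (Equivalence.to (gen a) a∈S) a≢0 =
    g , g∈ , a′ , Equivalence.from (gen a′) a′-comb , a≡

  module Apéry (S : NumericalSemigroup) {n : ℕ} .{{_ : NonZero n}} (n∈S : mem S n)
               (w : ℕ → ℕ) (apéry : ∀ i → i < n → IsAperyElem S n i (w i)) where

    open import Data.Nat.DivMod using (m%n<n)
    open Residues n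

    w∈S : ∀ {i} → i < n → mem S (w i)
    w∈S {i} i<n with w∈S , _ , _ ← apéry i i<n = w∈S

    w%n≡i : ∀ {i} → i < n → w i % n ≡ i
    w%n≡i {i} i<n with _ , w%n≡i , _ ← apéry i i<n = w%n≡i

    w-least : ∀ {i x} → i < n → mem S x → x % n ≡ i → w i ≤ x
    w-least {i} {x} i<n with _ , _ , least ← apéry i i<n = least x

    w[x%n]≤x⇒x∈S : ∀ {x} → w (x % n) ≤ x → mem S x
    w[x%n]≤x⇒x∈S {x} w≤x =
      subst (mem S) (sym x≡w+tn) (+-closed S (w∈S k<n) (*-closed S n∈S ((x ∸ w (x % n)) / n)))
      where
      k<n = m%n<n x n
      x≡w+tn = m%n≡o%n⇒m≡o+[m∸o]/n*n w≤x (sym (w%n≡i k<n))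

module IdealApérySet (q : ℕ) (S : NumericalSemigroup) {n : ℕ} .{{_ : NonZero n}} (n∈S : mem S n)
  (w : ℕ → ℕ) (apéry : ∀ i → i < n → IsAperyElem S n i (w i))
  (ss : List ℕ) (ss-range : All (λ s → 1 ≤ s × s < n) ss) (gen : GeneratedBy S (n ∷ map w ss)) where

  open import Data.Nat
  open import Data.Nat.Properties
  open import Data.Nat.DivMod using (m%n<n; m<n⇒m%n≡m; m%n%n≡m%n; %-remove-+ˡ; m*n≤o⇒[o∸m*n]%n≡o%n)
  open import Data.Nat.Divisibility using (n∣m*n)
  open import Data.Nat.ListAction using (sum)
  import Data.Nat.Tactic.RingSolver as ℕ
  open import Data.Integer as ℤ using (ℤ; +_)
    renaming (_+_ to _+ℤ_; _*_ to _*ℤ_; _-_ to _-ℤ_; -_ to -ℤ_; _⊓_ to _⊓ℤ_)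
  import Data.Integer.Properties as ℤ
  open import Data.Integer.DivMod using (n%ℕd<d)
  open import Data.Integer.Tactic.RingSolver using (solve-∀)
  open import Data.List using ([]; foldr; upTo)
  open import Data.List.Properties using (map-∘; map-cong; map-cong-local)
  open import Data.List.Membership.Propositional using (_∈_; lose)
  open import Data.List.Membership.Propositional.Properties using (∈-map⁺; ∈-map⁻; ∈-upTo⁻)
  import Data.List.Relation.Unary.All as All
  import Data.List.Relation.Unary.All.Properties as All
  open import Data.List.Relation.Unary.Any using (here; there)
  open import Data.Product using (_,_; proj₁; proj₂)
  open import Data.Sum using (inj₁; inj₂)
  open import Function using (_∘_)
  open import Function.Bundles using (_⇔_; mk⇔)
  open import Relation.Binary.PropositionalEquality
  open ≡-Reasoning
  open Residues n
  open MinimumFolds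
  open FiniteSets
  open NumericalSemigroups
  open Apéry S n∈S w apéry

  s<n : ∀ {i} → i ∈ ss → i < n
  s<n i∈ = proj₂ (All.lookup ss-range i∈)

  w[s]≢0 : ∀ {i} → i ∈ ss → w i ≢ 0
  w[s]≢0 {i} i∈ wi≡0 = <⇒≢ (proj₁ (All.lookup ss-range i∈)) (sym (begin
    i         ≡⟨ w%n≡i (s<n i∈) ⟨
    w i % n   ≡⟨ cong (_% n) wi≡0 ⟩
    0 % n     ≡⟨ m<n⇒m%n≡m (>-nonZero⁻¹ n) ⟩
    0         ∎))

  kIdx<n : ∀ k i → kIdx q n k i < n
  kIdx<n k i = n%ℕd<d (+ k -ℤ + (i * q)) n

  [q*w]%n≡[i*q]%n : ∀ {i} → i < n → (q * w i) % n ≡ (i * q) % n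
  [q*w]%n≡[i*q]%n {i} i<n =
    trans (%-congʳ-* q (trans (w%n≡i i<n) (sym (m<n⇒m%n≡m i<n)))) (cong (_% n) (*-comm q i))

  kIdx[q*w+y]≡y%n : ∀ {i} y → i < n → kIdx q n ((q * w i + y) % n) i ≡ y % n
  kIdx[q*w+y]≡y%n {i} y i<n = begin
    r        ≡⟨ m<n⇒m%n≡m (kIdx<n (x % n) i) ⟨
    r % n    ≡⟨ %-cancelʳ-+ r (i * q) y (begin
      (r + i * q) % n  ≡⟨ [[m-o]%ℕn+o]%n≡m%n (x % n) (i * q) ⟩
      x % n % n        ≡⟨ m%n%n≡m%n x n ⟩
      x % n            ≡⟨ %-cong-+ ([q*w]%n≡[i*q]%n i<n) refl ⟩
      (i * q + y) % n  ≡⟨ cong (_% n) (+-comm (i * q) y) ⟩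
      (y + i * q) % n  ∎) ⟩
    y % n    ∎
    where
    x = q * w i + y
    r = kIdx q n (x % n) i

  -- the least element of q·w(i) + S in the residue class k
  candidate : ℕ → ℕ → ℕ
  candidate k i = q * w i + w (kIdx q n k i)

  -- the least element of qS* + S in the residue class k
  idealApéry : ℕ → ℕ
  idealApéry k = foldr _⊓_ (q * n + w k) (map (candidate k) ss)

  candidate%n≡k : ∀ {k i} → k < n → i < n → candidate k i % n ≡ k
  candidate%n≡k {k} {i} k<n i<n = begin
    (q * w i + w r) % n  ≡⟨ %-cong-+ ([q*w]%n≡[i*q]%n i<n) (trans (w%n≡i r<n) (sym (m<n⇒m%n≡m r<n))) ⟩
    (i * q + r) % n      ≡⟨ cong (_% n) (+-comm (i * q) r) ⟩
    (r + i * q) % n      ≡⟨ [[m-o]%ℕn+o]%n≡m%n k (i * q) ⟩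
    k % n                ≡⟨ m<n⇒m%n≡m k<n ⟩
    k                    ∎
    where
    r = kIdx q n k i
    r<n = kIdx<n k i

  idealApéry%n≡k : ∀ {k} → k < n → idealApéry k % n ≡ k
  idealApéry%n≡k {k} k<n = foldr-⊓-preserves (λ v → v % n ≡ k)
    (trans (%-remove-+ˡ (w k) (n∣m*n q)) (w%n≡i k<n))
    (All.map⁺ (All.tabulate λ i∈ → candidate%n≡k k<n (s<n i∈)))

  w≤idealApéry : ∀ {k} → k < n → w k ≤ idealApéry k
  w≤idealApéry {k} k<n = foldr-⊓-preserves (w k ≤_) (m≤n+m (w k) (q * n))
    (All.map⁺ (All.tabulate λ {i} i∈ → w-least k<n (candidate∈S i∈) (candidate%n≡k k<n (s<n i∈))))
    where
    candidate∈S : ∀ {i} → i ∈ ss → mem S (candidate k i)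
    candidate∈S {i} i∈ = +-closed S (*-closed S (w∈S (s<n i∈)) q) (w∈S (kIdx<n k i))

  q*g+w[r]≤x⇒∈qS*+S : ∀ {g r x} → mem S g → g ≢ 0 → (x ∸ q * g) % n ≡ r → q * g + w r ≤ x →
                   InQSstarPlusS q S x
  q*g+w[r]≤x⇒∈qS*+S {g} {r} {x} g∈S g≢0 y%n≡r le =
    g , x ∸ q * g , g∈S , g≢0 , w[x%n]≤x⇒x∈S (subst (λ v → w v ≤ x ∸ q * g) (sym y%n≡r) w[r]≤y) ,
    sym (m+[n∸m]≡n (m+n≤o⇒m≤o (q * g) le))
    where
    w[r]≤y : w r ≤ x ∸ q * g
    w[r]≤y = m+n≤o⇒m≤o∸n (w r) (subst (_≤ x) (+-comm (q * g) (w r)) le)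

  idealApéry≤⇒∈qS*+S : ∀ {x} → idealApéry (x % n) ≤ x → InQSstarPlusS q S x
  idealApéry≤⇒∈qS*+S {x} = foldr-⊓-preserves (λ v → v ≤ x → InQSstarPlusS q S x)
    (λ le → q*g+w[r]≤x⇒∈qS*+S n∈S (≢-nonZero⁻¹ n) (m*n≤o⇒[o∸m*n]%n≡o%n q (m+n≤o⇒m≤o (q * n) le)) le)
    (All.map⁺ (All.tabulate via-generator))
    where
    via-generator : ∀ {i} → i ∈ ss → candidate (x % n) i ≤ x → InQSstarPlusS q S x
    via-generator {i} i∈ le = q*g+w[r]≤x⇒∈qS*+S (w∈S (s<n i∈)) (w[s]≢0 i∈) y%n≡r le
      where
      y%n≡r : (x ∸ q * w i) % n ≡ kIdx q n (x % n) i
      y%n≡r = sym (trans (cong (λ v → kIdx q n (v % n) i) (sym (m+[n∸m]≡n (m+n≤o⇒m≤o (q * w i) le))))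
                         (kIdx[q*w+y]≡y%n (x ∸ q * w i) (s<n i∈)))

  idealApéry≤q*g+y : ∀ {g y} → g ∈ n ∷ map w ss → mem S y → idealApéry ((q * g + y) % n) ≤ q * g + y
  idealApéry≤q*g+y {y = y} (here refl) y∈S = foldr-⊓-≤ _ (map (candidate _) ss) (inj₁ (+-monoʳ-≤ (q * n)
    (w-least (m%n<n (q * n + y) n) y∈S (sym (%-remove-+ˡ y (n∣m*n q))))))
  idealApéry≤q*g+y {y = y} (there g∈) y∈S with i , i∈ , refl ← ∈-map⁻ w g∈ =
    foldr-⊓-≤ _ (map (candidate _) ss) (inj₂ (lose (∈-map⁺ (candidate _) i∈) candidate≤))
    where
    candidate≤ : candidate ((q * w i + y) % n) i ≤ q * w i + y
    candidate≤ = +-monoʳ-≤ (q * w i) (w-least (kIdx<n _ i) y∈S (sym (kIdx[q*w+y]≡y%n y (s<n i∈))))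

  ∈qS*+S⇒idealApéry≤ : ∀ {x} → InQSstarPlusS q S x → idealApéry (x % n) ≤ x
  ∈qS*+S⇒idealApéry≤ {x} (a , b , a∈S , a≢0 , b∈S , x≡qa+b)
    with g , g∈ , a′ , a′∈S , a≡g+a′ ← ∈S*⇒generator+∈S {S} {n ∷ map w ss} gen a∈S a≢0 =
    subst (λ v → idealApéry (v % n) ≤ v) (sym x≡qg+y)
          (idealApéry≤q*g+y g∈ (+-closed S (*-closed S a′∈S q) b∈S))
    where
    x≡qg+y : x ≡ q * g + (q * a′ + b)
    x≡qg+y = begin
      x                    ≡⟨ x≡qa+b ⟩
      q * a + b            ≡⟨ cong (λ v → q * v + b) a≡g+a′ ⟩
      q * (g + a′) + b     ≡⟨ regroup q g a′ b ⟩
      q * g + (q * a′ + b) ∎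
      where
      regroup : ∀ q g a′ b → q * (g + a′) + b ≡ q * g + (q * a′ + b)
      regroup = ℕ.solve-∀

  open ResidueWindows w idealApéry w%n≡i idealApéry%n≡k w≤idealApéry

  InWindow⇔GMSet : ∀ x → InWindow x ⇔ GMSet q S x
  InWindow⇔GMSet x = mk⇔
    (λ (w≤x , x<idealApéry) → w[x%n]≤x⇒x∈S w≤x , <⇒≱ x<idealApéry ∘ ∈qS*+S⇒idealApéry≤)
    (λ (x∈S , x∉qS*+S) → w-least (m%n<n x n) x∈S refl , ≰⇒> (x∉qS*+S ∘ idealApéry≤⇒∈qS*+S))

  #GMSet : ℕ
  #GMSet = sum (map width (upTo n))

  GMSet-card : HasCard (GMSet q S) #GMSet
  GMSet-card = HasCard-cong InWindow⇔GMSet InWindow-card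

  minTerm≡idealApéry-w : ∀ k → minTerm q n w ss k ≡ + idealApéry k -ℤ + w k
  minTerm≡idealApéry-w k = sym (begin
    + idealApéry k -ℤ + w k
      ≡⟨ mono-distrib-foldr-⊓ (ℤ.+-monoˡ-≤ (-ℤ + w k)) (q * n + w k) (map (candidate k) ss) ⟩
    foldr _⊓ℤ_ (+ (q * n + w k) -ℤ + w k) (map (shift ∘ +_) (map (candidate k) ss))
      ≡⟨ cong₂ (foldr _⊓ℤ_) (x+y-y≡x (+ (q * n)) (+ w k))
               (trans (sym (map-∘ ss)) (map-cong (λ i → x+y-z≡x-z+y (+ (q * w i)) _ (+ w k)) ss)) ⟩
    minTerm q n w ss k ∎)
    where
    shift : ℤ → ℤ
    shift v = v -ℤ + w k
    x+y-y≡x : ∀ x y → x +ℤ y -ℤ y ≡ x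
    x+y-y≡x = solve-∀
    x+y-z≡x-z+y : ∀ x y z → x +ℤ y -ℤ z ≡ x -ℤ z +ℤ y
    x+y-z≡x-z+y = solve-∀

  minTerm≡n*width : ∀ {k} → k < n → minTerm q n w ss k ≡ + (n * width k)
  minTerm≡n*width {k} k<n = begin
    minTerm q n w ss k                    ≡⟨ minTerm≡idealApéry-w k ⟩
    + idealApéry k -ℤ + w k               ≡⟨ cong (λ v → + v -ℤ + w k) (hi≡lo+width*n k<n) ⟩
    + w k +ℤ + (width k * n) -ℤ + w k     ≡⟨ x+y-x≡y (+ w k) _ ⟩
    + (width k * n)                       ≡⟨ cong +_ (*-comm (width k) n) ⟩
    + (n * width k)                       ∎
    where
    x+y-x≡y : ∀ x y → x +ℤ y -ℤ x ≡ y
    x+y-x≡y = solve-∀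

  GM-formula : + n *ℤ + suc #GMSet ≡ + n +ℤ theSum q n w ss
  GM-formula = begin
    + n *ℤ + suc #GMSet                              ≡⟨ ℤ.pos-* n (suc #GMSet) ⟨
    + (n * suc #GMSet)                               ≡⟨ cong +_ (*-suc n #GMSet) ⟩
    + n +ℤ + (n * #GMSet)                            ≡⟨ cong (+ n +ℤ_) (sumℤ-scaled width (upTo n)) ⟨
    + n +ℤ sumℤ (map (λ k → + (n * width k)) (upTo n))
      ≡⟨ cong (λ ts → + n +ℤ sumℤ ts) (map-cong-local (All.tabulate (minTerm≡n*width ∘ ∈-upTo⁻))) ⟨
    + n +ℤ theSum q n w ss                           ∎
    where
    sumℤ-scaled : ∀ (f : ℕ → ℕ) ks → sumℤ (map (λ k → + (n * f k)) ks) ≡ + (n * sum (map f ks))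
    sumℤ-scaled f []       = cong +_ (sym (*-zeroʳ n))
    sumℤ-scaled f (k ∷ ks) =
      trans (cong (+ (n * f k) +ℤ_) (sumℤ-scaled f ks)) (cong +_ (sym (*-distribˡ-+ n (f k) _)))

open import Data.Nat.Base using (suc)
open import Data.Integer using (+_; _*_; _+_)
open import Data.Product using (Σ; _,_)

corollary3p4 : (q : ℕ) → 0 < q → (S : NumericalSemigroup) →
    (n : ℕ) .{{_ : NonZero n}} → mem S n →
    (w : ℕ → ℕ) → (∀ i → i < n → IsAperyElem S n i (w i)) →
    (ss : List ℕ) → All (λ s → 1 ≤ s × s < n) ss →
    GeneratedBy S (n ∷ map w ss) →
    Σ ℕ λ c → HasCard (GMSet q S) c ×
    (+ n) * (+ suc c) ≡ + n + theSum q n w ss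
corollary3p4 q _ S n n∈S w apéry ss ss-range gen = #GMSet , GMSet-card , GM-formula
  where open IdealApérySet q S n∈S w apéry ss ss-range gen
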